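{- For each constant $c > 1/8$, there exist $n_0 = n_0(c)$ and $\varepsilon = \varepsilon(c) > 0$ such that for every $n > n_0$ there exists a graph $G$ on $n$ vertices with $\delta(G)\geq (1/2+\varepsilon)n$ and a proper $cn$-bounded edge-colouring of $G$ such that every Hamilton cycle in $G$ contains at most $(1-\varepsilon)n$ distinct colours.
   Context: An edge-colouring is proper if any two edges sharing an endpoint receive different colours; it is $b$-bounded if every colour is assigned to at most $b$ edges. $\delta(G)$ denotes the minimum degree of $G$. -}

module Defs where

open import Data.Bool using (Bool; true; false; if_then_else_; _∧_; T)
open import Data.Nat as ℕ using (ℕ; zero; suc)
open import Data.Fin using (Fin; toℕ; fromℕ; lower₁) renaming (zero to fzero; suc to fsuc)
open import Data.Fin.Permutation using (Permutation′; _⟨$⟩ʳ_)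
open import Data.List using (List; map; length; deduplicate; allFin)
open import Data.Nat.ListAction using (sum)
open import Data.Integer using (+_)
open import Data.Rational using (ℚ; _/_)
open import Relation.Binary.PropositionalEquality using (_≡_; _≢_)
open import Relation.Nullary using (yes; no; ¬_)

ℕtoℚ : ℕ → ℚ
ℕtoℚ k = + k / 1

record Graph (n : ℕ) : Set where
  field
    adj   : Fin n → Fin n → Bool
    sym   : ∀ u v → adj u v ≡ adj v u
    irref : ∀ v → adj v v ≡ false
open Graph public

countᵇ : {A : Set} → (A → Bool) → List A → ℕ
countᵇ p xs = sum (map (λ x → if p x then 1 else 0) xs)

degree : ∀ {n} → Graph n → Fin n → ℕ
degree G v = countᵇ (λ u → adj G v u) (allFin _)

MinDegreeAtLeast : ∀ {n} → Graph n → ℚ → Set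
MinDegreeAtLeast {n} G q = ∀ v → q Data.Rational.* ℕtoℚ n Data.Rational.≤ ℕtoℚ (degree G v)

-- an edge-colouring: a colour (a natural number) for each pair, symmetric;
-- only its values on edges matter
record EdgeColouring {n : ℕ} (G : Graph n) : Set where
  field
    col    : Fin n → Fin n → ℕ
    colSym : ∀ u v → col u v ≡ col v u
open EdgeColouring public

Proper : ∀ {n} {G : Graph n} → EdgeColouring G → Set
Proper {n} {G} c = ∀ u v w → T (adj G u v) → T (adj G u w) → v ≢ w → col c u v ≢ col c u w

edgesOfColour : ∀ {n} {G : Graph n} → EdgeColouring G → ℕ → ℕ
edgesOfColour {n} {G} c k =
  sum (map (λ u → countᵇ (λ v → (toℕ u ℕ.<ᵇ toℕ v) ∧ adj G u v ∧ (col c u v ℕ.≡ᵇ k)) (allFin n)) (allFin n))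

Bounded : ∀ {n} {G : Graph n} → EdgeColouring G → ℚ → Set
Bounded c b = ∀ k → ℕtoℚ (edgesOfColour c k) Data.Rational.≤ b

cycNext : ∀ {n} → Fin n → Fin n
cycNext {suc m} i with m ℕ.≟ toℕ i
... | yes _ = fzero
... | no ne = fsuc (lower₁ i ne)

record HamiltonCycle {n : ℕ} (G : Graph n) : Set where
  field
    σ     : Permutation′ n
    edges : ∀ i → T (adj G (σ ⟨$⟩ʳ i) (σ ⟨$⟩ʳ cycNext i))
open HamiltonCycle public

coloursOn : ∀ {n} {G : Graph n} → EdgeColouring G → HamiltonCycle G → ℕ
coloursOn {n} c H =
  length (deduplicate ℕ._≟_ (map (λ i → col c (σ H ⟨$⟩ʳ i) (σ H ⟨$⟩ʳ cycNext i)) (allFin n)))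

-- Split the vertices into X and Y of size m, a little more than n/4, and Z, the rest. Z is joined to
-- everything, and between X and Y sits the d-regular circulant graph a ~ j iff a − j mod m < d, so all
-- degrees are at least |Z| + d; taking d ≈ 2m − n/2 makes this (1/2 + ε) n. Edges at Z get pairwise
-- distinct colours. The X–Y edges form d perfect matchings, one per value of a − j mod m; laid end to
-- end and cut into blocks of L < m consecutive edges, every block is still a matching, and it becomes
-- one colour class. A Hamilton cycle has at most 2|Z| edges at Z, so it sees at most dm/L + 2|Z|
-- colours, and since m/L < 2 this is below (4m − n) + 2(n − 2m) = n by a margin of ε n. The classes
-- have size L > m/2 > n/8, which must stay below c n: this is where c > 1/8 is needed.

module Submission where

open import Data.Bool using (Bool; true; false; if_then_else_; T; not; _∧_; _∨_)
open import Data.Bool.Properties using (T?; T-∧; T-∨; T-not-≡)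
open import Data.Empty using (⊥; ⊥-elim)
open import Data.Fin using (Fin; toℕ)
open import Data.Fin.Permutation using (Permutation′; _⟨$⟩ʳ_; _⟨$⟩ˡ_; inverseˡ)
open import Data.Fin.Properties using (toℕ<n; toℕ-injective; toℕ-lower₁) renaming (suc-injective to fsuc-injective)
open import Data.Integer using (-[1+_])
import Data.Integer as ℤ
import Data.Integer.Properties as ℤ
open import Data.List
  using (List; []; _∷_; _++_; length; map; filterᵇ; deduplicate; tabulate; allFin; upTo; applyUpTo; cartesianProduct)
open import Data.List.Properties
  using (length-map; length-++; length-applyUpTo; length-upTo; map-applyUpTo; map-tabulate; map-id; map-cong)
open import Data.List.Membership.Propositional using (_∈_)
open import Data.List.Membership.Propositional.Properties
  using (∈-map⁻; ∈-filter⁺; ∈-filter⁻; ∈-++⁻; ∈-applyUpTo⁺; ∈-applyUpTo⁻; ∈-upTo⁺; ∈-upTo⁻;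
         ∈-cartesianProduct⁻; ∈-deduplicate⁻)
open import Data.List.Relation.Unary.Any using (here; there)
import Data.List.Relation.Unary.All as All
import Data.List.Relation.Unary.AllPairs as AllPairs
open import Data.List.Relation.Unary.Unique.Propositional using (Unique)
import Data.List.Relation.Unary.Unique.Propositional.Properties as Unique
open import Data.List.Relation.Unary.Unique.DecPropositional.Properties using (deduplicate-!)
open import Data.Nat
open import Data.Nat.Coprimality using (1-coprimeTo)
open import Data.Nat.DivMod
open import Data.Nat.ListAction using (sum)
open import Data.Nat.Properties
open import Data.Nat.Tactic.RingSolver using (solve-∀; solve)
open import Data.Product using (Σ; _×_; _,_; proj₁; proj₂; uncurry)
open import Data.Rational using (ℚ; mkℚ; 0ℚ; 1ℚ; ½; toℚᵘ)
import Data.Rational as Q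
open import Data.Rational.Properties using (toℚᵘ-cancel-≤; toℚᵘ-homo-+; toℚᵘ-homo-*; toℚᵘ-homo‿-; toℚᵘ-fromℚᵘ)
open import Data.Rational.Unnormalised using (mkℚᵘ) renaming (_≃_ to _≃ᵘ_)
import Data.Rational.Unnormalised as ℚᵘ
import Data.Rational.Unnormalised.Properties as ℚᵘ
open import Data.Sum using (_⊎_; inj₁; inj₂)
open import Function using (_∘_; id; case_of_)
open import Function.Bundles using (Equivalence)
open import Relation.Binary.Definitions using (tri<; tri≈; tri>)
open import Relation.Binary.PropositionalEquality
open import Relation.Nullary using (¬_; yes; no; Dec)
open import Relation.Nullary.Decidable using (_×-dec_; _⊎-dec_; ⌊_⌋; toWitness; fromWitness)

open import Defs
  using (ℕtoℚ; Graph; countᵇ; degree; MinDegreeAtLeast; EdgeColouring; Proper; edgesOfColour; Bounded;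
         cycNext; HamiltonCycle; coloursOn)

private variable A A′ : Set

-- Counting

private
  remove : {x : A} {ys : List A} → x ∈ ys → List A
  remove {ys = y ∷ ys} (here _)  = ys
  remove {ys = y ∷ ys} (there p) = y ∷ remove p

  length-remove : {x : A} {ys : List A} (p : x ∈ ys) → length ys ≡ suc (length (remove p))
  length-remove (here _)  = refl
  length-remove (there p) = cong suc (length-remove p)

  ∈-remove : {x z : A} {ys : List A} (p : x ∈ ys) → z ∈ ys → z ≢ x → z ∈ remove p
  ∈-remove (here refl) (here refl) z≢x = ⊥-elim (z≢x refl)
  ∈-remove (here _)    (there q)   _   = q
  ∈-remove (there p)   (here refl) _   = here refl
  ∈-remove (there p)   (there q)   z≢x = there (∈-remove p q z≢x)

Unique-⊆⇒length≤ : {xs ys : List A} → Unique xs → (∀ {z} → z ∈ xs → z ∈ ys) → length xs ≤ length ys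
Unique-⊆⇒length≤ AllPairs.[] _ = z≤n
Unique-⊆⇒length≤ {xs = x ∷ xs} {ys} (x∉xs AllPairs.∷ !xs) xs⊆ys = begin
  suc (length xs)            ≤⟨ s≤s (Unique-⊆⇒length≤ !xs (λ z∈xs → ∈-remove x∈ys (xs⊆ys (there z∈xs)) (x≢ z∈xs))) ⟩
  suc (length (remove x∈ys)) ≡⟨ length-remove x∈ys ⟨
  length ys                  ∎
  where
  open ≤-Reasoning
  x∈ys = xs⊆ys (here refl)
  x≢ : ∀ {z} → z ∈ xs → z ≢ x
  x≢ z∈xs z≡x = All.lookup x∉xs z∈xs (sym z≡x)

Unique-map⁺ : (f : A → A′) {xs : List A} → (∀ {x y} → x ∈ xs → y ∈ xs → f x ≡ f y → x ≡ y) →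
  Unique xs → Unique (map f xs)
Unique-map⁺ f f-inj AllPairs.[] = AllPairs.[]
Unique-map⁺ f {x ∷ xs} f-inj (x∉xs AllPairs.∷ !xs) =
  All.tabulate fx≢ AllPairs.∷ Unique-map⁺ f (λ x∈ y∈ → f-inj (there x∈) (there y∈)) !xs
  where
  fx≢ : ∀ {z} → z ∈ map f xs → f x ≢ z
  fx≢ z∈ fx≡z with ∈-map⁻ f z∈
  ... | y , y∈xs , refl = All.lookup x∉xs y∈xs (f-inj (here refl) (there y∈xs) fx≡z)

countᵇ≡length-filterᵇ : (p : A → Bool) (xs : List A) → countᵇ p xs ≡ length (filterᵇ p xs)
countᵇ≡length-filterᵇ p []       = refl
countᵇ≡length-filterᵇ p (x ∷ xs) with p x
... | true  = cong suc (countᵇ≡length-filterᵇ p xs)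
... | false = countᵇ≡length-filterᵇ p xs

countᵇ≤length-by-injection : (p : A → Bool) (f : A → A′) {xs : List A} (ys : List A′) → Unique xs →
  (∀ {x y} → x ∈ xs → y ∈ xs → T (p x) → T (p y) → f x ≡ f y → x ≡ y) →
  (∀ {x} → x ∈ xs → T (p x) → f x ∈ ys) →
  countᵇ p xs ≤ length ys
countᵇ≤length-by-injection p f {xs} ys !xs f-inj f∈ys = begin
  countᵇ p xs                   ≡⟨ countᵇ≡length-filterᵇ p xs ⟩
  length (filterᵇ p xs)         ≡⟨ length-map f (filterᵇ p xs) ⟨
  length (map f (filterᵇ p xs)) ≤⟨ Unique-⊆⇒length≤ !image image⊆ys ⟩
  length ys                     ∎
  where
  open ≤-Reasoning
  !image : Unique (map f (filterᵇ p xs))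
  !image = Unique-map⁺ f (λ x∈ y∈ → let x∈xs , px = ∈-filter⁻ (T? ∘ p) x∈ ; y∈xs , py = ∈-filter⁻ (T? ∘ p) y∈
                                    in f-inj x∈xs y∈xs px py)
                       (Unique.filter⁺ (T? ∘ p) !xs)
  image⊆ys : ∀ {z} → z ∈ map f (filterᵇ p xs) → z ∈ ys
  image⊆ys z∈ with ∈-map⁻ f z∈
  ... | x , x∈ , refl = let x∈xs , px = ∈-filter⁻ (T? ∘ p) x∈ in f∈ys x∈xs px

length≤countᵇ-by-witnesses : (p : A → Bool) {xs ys : List A} → Unique ys →
  (∀ {y} → y ∈ ys → y ∈ xs × T (p y)) → length ys ≤ countᵇ p xs
length≤countᵇ-by-witnesses p {xs} !ys ys⊆ =
  subst (_ ≤_) (sym (countᵇ≡length-filterᵇ p xs))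
    (Unique-⊆⇒length≤ !ys (λ y∈ys → let y∈xs , py = ys⊆ y∈ys in ∈-filter⁺ (T? ∘ p) y∈xs py))

countᵇ-mono-⊆ : (p : A → Bool) {xs ys : List A} → Unique xs → (∀ {z} → z ∈ xs → z ∈ ys) →
  countᵇ p xs ≤ countᵇ p ys
countᵇ-mono-⊆ p {xs} !xs xs⊆ys = subst (_≤ _) (sym (countᵇ≡length-filterᵇ p xs))
  (length≤countᵇ-by-witnesses p (Unique.filter⁺ (T? ∘ p) !xs)
    (λ z∈ → let z∈xs , pz = ∈-filter⁻ (T? ∘ p) z∈ in xs⊆ys z∈xs , pz))

countᵇ-mono : (p q : A → Bool) (xs : List A) → (∀ x → T (p x) → T (q x)) → countᵇ p xs ≤ countᵇ q xs
countᵇ-mono p q []       p⇒q = z≤n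
countᵇ-mono p q (x ∷ xs) p⇒q with p x | q x | p⇒q x
... | true  | true  | _   = s≤s (countᵇ-mono p q xs p⇒q)
... | true  | false | px⇒ = ⊥-elim (px⇒ _)
... | false | true  | _   = m≤n⇒m≤1+n (countᵇ-mono p q xs p⇒q)
... | false | false | _   = countᵇ-mono p q xs p⇒q

countᵇ-∨ : (p q : A → Bool) (xs : List A) → countᵇ (λ x → p x ∨ q x) xs ≤ countᵇ p xs + countᵇ q xs
countᵇ-∨ p q []       = z≤n
countᵇ-∨ p q (x ∷ xs) with p x | q x
... | true  | true  = s≤s (≤-trans (m≤n⇒m≤1+n (countᵇ-∨ p q xs)) (≤-reflexive (sym (+-suc _ _))))
... | true  | false = s≤s (countᵇ-∨ p q xs)
... | false | true  = ≤-trans (s≤s (countᵇ-∨ p q xs)) (≤-reflexive (sym (+-suc _ _)))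
... | false | false = countᵇ-∨ p q xs

length≡countᵇ+countᵇ-not : (p : A → Bool) (xs : List A) → length xs ≡ countᵇ p xs + countᵇ (not ∘ p) xs
length≡countᵇ+countᵇ-not p []       = refl
length≡countᵇ+countᵇ-not p (x ∷ xs) with p x
... | true  = cong suc (length≡countᵇ+countᵇ-not p xs)
... | false = trans (cong suc (length≡countᵇ+countᵇ-not p xs)) (sym (+-suc _ _))

countᵇ-map : (p : A′ → Bool) (f : A → A′) (xs : List A) → countᵇ p (map f xs) ≡ countᵇ (p ∘ f) xs
countᵇ-map p f []       = refl
countᵇ-map p f (x ∷ xs) = cong ((if p (f x) then 1 else 0) +_) (countᵇ-map p f xs)

countᵇ-++ : (p : A → Bool) (xs ys : List A) → countᵇ p (xs ++ ys) ≡ countᵇ p xs + countᵇ p ys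
countᵇ-++ p []       ys = refl
countᵇ-++ p (x ∷ xs) ys =
  trans (cong ((if p x then 1 else 0) +_) (countᵇ-++ p xs ys)) (sym (+-assoc (if p x then 1 else 0) (countᵇ p xs) (countᵇ p ys)))

sum-countᵇ≡countᵇ-cartesianProduct : (g : A → A′ → Bool) (xs : List A) (ys : List A′) →
  sum (map (λ x → countᵇ (g x) ys) xs) ≡ countᵇ (uncurry g) (cartesianProduct xs ys)
sum-countᵇ≡countᵇ-cartesianProduct g []       ys = refl
sum-countᵇ≡countᵇ-cartesianProduct g (x ∷ xs) ys = begin
  countᵇ (g x) ys + sum (map (λ x → countᵇ (g x) ys) xs)
    ≡⟨ cong₂ _+_ (countᵇ-map (uncurry g) (x ,_) ys) (sym (sum-countᵇ≡countᵇ-cartesianProduct g xs ys)) ⟨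
  countᵇ (uncurry g) (map (x ,_) ys) + countᵇ (uncurry g) (cartesianProduct xs ys)
    ≡⟨ countᵇ-++ (uncurry g) (map (x ,_) ys) (cartesianProduct xs ys) ⟨
  countᵇ (uncurry g) (cartesianProduct (x ∷ xs) ys) ∎
  where open ≡-Reasoning

interval : ℕ → ℕ → List ℕ
interval a = applyUpTo (a +_)

∈-interval⁺ : ∀ {a l x} → a ≤ x → x < a + l → x ∈ interval a l
∈-interval⁺ {a} {l} {x} a≤x x<a+l = subst (_∈ interval a l) (m+[n∸m]≡n a≤x)
  (∈-applyUpTo⁺ (a +_) (+-cancelˡ-< a (x ∸ a) l (subst (_< a + l) (sym (m+[n∸m]≡n a≤x)) x<a+l)))

∈-interval⁻ : ∀ {a l x} → x ∈ interval a l → a ≤ x × x < a + l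
∈-interval⁻ {a} x∈ with ∈-applyUpTo⁻ (a +_) x∈
... | i , i<l , refl = m≤m+n a i , +-monoʳ-< a i<l

interval-Unique : ∀ a l → Unique (interval a l)
interval-Unique a l = Unique.applyUpTo⁺₁ (a +_) l (λ i<j _ eq → <⇒≢ i<j (+-cancelˡ-≡ a _ _ eq))

private
  tabulate-∘toℕ : ∀ n (f : ℕ → A) → tabulate {n = n} (f ∘ toℕ) ≡ applyUpTo f n
  tabulate-∘toℕ zero    f = refl
  tabulate-∘toℕ (suc n) f = cong (f 0 ∷_) (tabulate-∘toℕ n (f ∘ suc))

map-∘toℕ-allFin : ∀ n (f : ℕ → A) → map (f ∘ toℕ) (allFin n) ≡ map f (upTo n)
map-∘toℕ-allFin n f =
  trans (map-tabulate {n = n} id (f ∘ toℕ)) (trans (tabulate-∘toℕ n f) (sym (map-applyUpTo id f n)))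

countᵇ-allFin : ∀ n (p : ℕ → Bool) → countᵇ (p ∘ toℕ) (allFin n) ≡ countᵇ p (upTo n)
countᵇ-allFin n p = begin
  countᵇ (p ∘ toℕ) (allFin n)   ≡⟨ countᵇ-map p toℕ (allFin n) ⟨
  countᵇ p (map toℕ (allFin n)) ≡⟨ cong (countᵇ p) (map-∘toℕ-allFin n id) ⟩
  countᵇ p (map id (upTo n))    ≡⟨ cong (countᵇ p) (map-id (upTo n)) ⟩
  countᵇ p (upTo n)             ∎
  where open ≡-Reasoning

-- Arithmetic modulo m on [0, m)

*+-injective : ∀ {q q' r r' n} → r < n → r' < n → q * n + r ≡ q' * n + r' → q ≡ q' × r ≡ r'
*+-injective {q} {q'} {r} {r'} {n@(suc _)} r<n r'<n eq = q≡q' , r≡r'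
  where
  remainder : ∀ q r → r < n → (q * n + r) % n ≡ r
  remainder q r r<n = trans (cong (_% n) (+-comm (q * n) r)) (trans ([m+kn]%n≡m%n r q n) (m<n⇒m%n≡m r<n))
  r≡r' : r ≡ r'
  r≡r' = trans (sym (remainder q r r<n)) (trans (cong (_% n) eq) (remainder q' r' r'<n))
  q≡q' : q ≡ q'
  q≡q' = *-cancelʳ-≡ q q' n (+-cancelʳ-≡ r (q * n) (q' * n) (trans eq (cong (q' * n +_) (sym r≡r'))))

module Circulant (m : ℕ) where

  -- For a, j, s < m: a ≡ j + s (mod m).
  Offset : ℕ → ℕ → ℕ → Set
  Offset a j s = j + s ≡ a ⊎ j + s ≡ a + m

  offset : ℕ → ℕ → ℕ
  offset a j with j ≤? a
  ... | yes _ = a ∸ j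
  ... | no  _ = a + m ∸ j

  _⊕_ : ℕ → ℕ → ℕ
  j ⊕ s with j + s <? m
  ... | yes _ = j + s
  ... | no  _ = j + s ∸ m

  offset-spec : ∀ {a j} → a < m → j < m → offset a j < m × Offset a j (offset a j)
  offset-spec {a} {j} a<m j<m with j ≤? a
  ... | yes j≤a = ≤-<-trans (m∸n≤m a j) a<m , inj₁ (m+[n∸m]≡n j≤a)
  ... | no  j≰a = +-cancelˡ-< j (a + m ∸ j) m (subst (_< j + m) (sym (m+[n∸m]≡n j≤a+m)) (+-monoˡ-< m (≰⇒> j≰a)))
                , inj₂ (m+[n∸m]≡n j≤a+m)
    where j≤a+m = ≤-trans (<⇒≤ j<m) (m≤n+m m a)

  ⊕-spec : ∀ {j s} → j < m → s < m → j ⊕ s < m × Offset (j ⊕ s) j s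
  ⊕-spec {j} {s} j<m s<m with j + s <? m
  ... | yes j+s<m = j+s<m , inj₁ refl
  ... | no  j+s≮m = +-cancelˡ-< m (j + s ∸ m) m (subst (_< m + m) (sym (m+[n∸m]≡n m≤j+s)) (+-mono-< j<m s<m))
                  , inj₂ (sym (m∸n+n≡m m≤j+s))
    where m≤j+s = ≮⇒≥ j+s≮m

  Offset-comm : ∀ {a j s} → Offset a j s → Offset a s j
  Offset-comm {j = j} {s} (inj₁ e) = inj₁ (trans (+-comm s j) e)
  Offset-comm {j = j} {s} (inj₂ e) = inj₂ (trans (+-comm s j) e)

  private
    +m-absurd : ∀ {x y} → x < m → x ≡ y + m → ⊥
    +m-absurd {x} {y} x<m refl = <⇒≱ x<m (m≤n+m m y)

  Offset-cancelʳ : ∀ {a j s s'} → s < m → s' < m → Offset a j s → Offset a j s' → s ≡ s'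
  Offset-cancelʳ {j = j} _ _ (inj₁ e) (inj₁ e') = +-cancelˡ-≡ j _ _ (trans e (sym e'))
  Offset-cancelʳ {j = j} _ _ (inj₂ e) (inj₂ e') = +-cancelˡ-≡ j _ _ (trans e (sym e'))
  Offset-cancelʳ {a} {j} {s} {s'} _ s'<m (inj₁ e) (inj₂ e') = ⊥-elim (+m-absurd s'<m
    (+-cancelˡ-≡ j _ _ (trans e' (trans (cong (_+ m) (sym e)) (+-assoc j s m)))))
  Offset-cancelʳ {a} {j} {s} {s'} s<m _ (inj₂ e) (inj₁ e') = ⊥-elim (+m-absurd s<m
    (+-cancelˡ-≡ j _ _ (trans e (trans (cong (_+ m) (sym e')) (+-assoc j s' m)))))

  Offset-cancelˡ : ∀ {a a' j s} → a < m → a' < m → Offset a j s → Offset a' j s → a ≡ a'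
  Offset-cancelˡ _   _    (inj₁ e) (inj₁ e') = trans (sym e) e'
  Offset-cancelˡ _   _    (inj₂ e) (inj₂ e') = +-cancelʳ-≡ m _ _ (trans (sym e) e')
  Offset-cancelˡ a<m _    (inj₁ e) (inj₂ e') = ⊥-elim (+m-absurd a<m (trans (sym e) e'))
  Offset-cancelˡ _   a'<m (inj₂ e) (inj₁ e') = ⊥-elim (+m-absurd a'<m (trans (sym e') e))

  offset<m : ∀ {a j} → a < m → j < m → offset a j < m
  offset<m a<m j<m = proj₁ (offset-spec a<m j<m)

  ⊕<m : ∀ {j s} → j < m → s < m → j ⊕ s < m
  ⊕<m j<m s<m = proj₁ (⊕-spec j<m s<m)

  offset-⊕ : ∀ {j s} → j < m → s < m → offset (j ⊕ s) j ≡ s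
  offset-⊕ j<m s<m = Offset-cancelʳ (offset<m (⊕<m j<m s<m) j<m) s<m
    (proj₂ (offset-spec (⊕<m j<m s<m) j<m)) (proj₂ (⊕-spec j<m s<m))

  offset-involutive : ∀ {a s} → a < m → s < m → offset a (offset a s) ≡ s
  offset-involutive {a} {s} a<m s<m = Offset-cancelʳ (offset<m a<m t<m) s<m
    (proj₂ (offset-spec a<m t<m)) (Offset-comm {j = s} (proj₂ (offset-spec a<m s<m)))
    where t<m = offset<m a<m s<m

  offset-injectiveʳ : ∀ {a j j'} → a < m → j < m → j' < m → offset a j ≡ offset a j' → j ≡ j'
  offset-injectiveʳ {a} a<m j<m j'<m eq =
    trans (sym (offset-involutive a<m j<m)) (trans (cong (offset a) eq) (offset-involutive a<m j'<m))

  offset-injectiveˡ : ∀ {a a' j} → a < m → a' < m → j < m → offset a j ≡ offset a' j → a ≡ a'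
  offset-injectiveˡ {a} {a'} {j} a<m a'<m j<m eq = Offset-cancelˡ {j = j} {s = offset a' j} a<m a'<m
    (subst (Offset a j) eq (proj₂ (offset-spec a<m j<m))) (proj₂ (offset-spec {a'} {j} a'<m j<m))

  Offset-gap : ∀ {a j j' s δ} → j < m → Offset a j s → Offset a j' (s + δ) → j ≤ δ + j'
  Offset-gap {a} {j} {j'} {s} {δ} j<m = gap
    where
    rearrange : j' + (s + δ) ≡ δ + j' + s
    rearrange = solve (j' ∷ s ∷ δ ∷ [])
    +-swap : ∀ x y z → x + y + z ≡ x + z + y
    +-swap = solve-∀
    gap : Offset a j s → Offset a j' (s + δ) → j ≤ δ + j'
    gap (inj₁ e) (inj₁ e') = ≤-reflexive (+-cancelʳ-≡ s j (δ + j') (trans e (trans (sym e') rearrange)))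
    gap (inj₂ e) (inj₂ e') = ≤-reflexive (+-cancelʳ-≡ s j (δ + j') (trans e (trans (sym e') rearrange)))
    gap (inj₁ e) (inj₂ e') = ≤-trans (m≤m+n j m) (≤-reflexive (+-cancelʳ-≡ s (j + m) (δ + j')
      (trans (+-swap j m s) (trans (cong (_+ m) e) (trans (sym e') rearrange)))))
    gap (inj₂ e) (inj₁ e') = ⊥-elim (<⇒≱ j<m (≤-trans (m≤n+m m (δ + j')) (≤-reflexive (+-cancelʳ-≡ s (δ + j' + m) j
      (trans (+-swap (δ + j') m s) (trans (cong (_+ m) (trans (sym rearrange) e')) (sym e)))))))

  key : ℕ → ℕ → ℕ
  key a j = offset a j * m + j

  key-injective : ∀ {a a' j j'} → a < m → a' < m → j < m → j' < m → key a j ≡ key a' j' → a ≡ a' × j ≡ j'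
  key-injective {a} {a'} {j} {j'} a<m a'<m j<m j'<m eq with *+-injective {offset a j} {offset a' j'} j<m j'<m eq
  ... | s≡s' , refl = offset-injectiveˡ a<m a'<m j<m s≡s' , refl

  key-gap-same-j : ∀ {L a a' j} → L ≤ m → offset a j < offset a' j → key a j + L ≤ key a' j
  key-gap-same-j {L} {a} {a'} {j} L≤m s<s' = begin
    offset a j * m + j + L       ≤⟨ +-monoʳ-≤ (offset a j * m + j) L≤m ⟩
    offset a j * m + j + m       ≡⟨ +-swap (offset a j * m) j m ⟩
    suc (offset a j) * m + j     ≤⟨ +-monoˡ-≤ j (*-monoˡ-≤ m s<s') ⟩
    offset a' j * m + j          ∎
    where
    open ≤-Reasoning
    +-swap : ∀ x y z → x + y + z ≡ z + x + y
    +-swap = solve-∀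

  -- Edges at the same a lie in different matchings, and going s → s + δ moves j back by δ (mod m),
  -- so their keys are at least m − 1 ≥ L apart.
  key-gap-same-a : ∀ {L a j j'} → L < m → a < m → j < m → j' < m → offset a j < offset a j' →
    key a j + L ≤ key a j'
  key-gap-same-a {L} {a} {j} {j'} L<m a<m j<m j'<m s<s' with m≤n⇒∃[o]m+o≡n s<s'
  ... | o , 1+s+o≡s' = begin
    s * m + j + L                  ≤⟨ +-monoˡ-≤ L (+-monoʳ-≤ (s * m) j≤1+o+j') ⟩
    s * m + (suc o + j') + L       ≡⟨ +-swap (s * m) (suc o) j' L ⟩
    s * m + (suc o + L) + j'       ≤⟨ +-monoˡ-≤ j' (+-monoʳ-≤ (s * m) 1+o+L≤[1+o]*m) ⟩
    s * m + suc o * m + j'         ≡⟨ cong (_+ j') (*-distribʳ-+ m s (suc o)) ⟨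
    (s + suc o) * m + j'           ≡⟨ cong (λ t → t * m + j') s+1+o≡s' ⟩
    offset a j' * m + j'           ∎
    where
    open ≤-Reasoning
    s = offset a j
    s+1+o≡s' : s + suc o ≡ offset a j'
    s+1+o≡s' = trans (+-suc s o) 1+s+o≡s'
    j≤1+o+j' : j ≤ suc o + j'
    j≤1+o+j' = Offset-gap {s = s} {δ = suc o} j<m (proj₂ (offset-spec a<m j<m))
      (subst (Offset a j') (sym s+1+o≡s') (proj₂ (offset-spec a<m j'<m)))
    1+o+L≤[1+o]*m : suc o + L ≤ suc o * m
    1+o+L≤[1+o]*m = subst (_≤ suc o * m) (cong suc (+-comm L o))
      (+-mono-≤ L<m (subst (_≤ o * m) (*-identityʳ o) (*-monoʳ-≤ o (≤-trans (s≤s z≤n) L<m))))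
    +-swap : ∀ x y z w → x + (y + z) + w ≡ x + (y + w) + z
    +-swap = solve-∀

/-mono-gap : ∀ {L} .{{_ : NonZero L}} {e e'} → e + L ≤ e' → e / L < e' / L
/-mono-gap {L} {e} {e'} e+L≤e' = begin-strict
  e / L                 <⟨ n<1+n (e / L) ⟩
  suc (e / L)           ≡⟨ cong (λ x → suc (x / L)) (m+n∸n≡m e L) ⟨
  suc ((e + L ∸ L) / L) ≡⟨ m/n≡1+[m∸n]/n (m≤n+m L e) ⟨
  (e + L) / L           ≤⟨ /-monoˡ-≤ L e+L≤e' ⟩
  e' / L                ∎
  where open ≤-Reasoning

/-block-bounds : ∀ {L} .{{_ : NonZero L}} {e k} → e / L ≡ k → k * L ≤ e × e < k * L + L
/-block-bounds {L} {e} refl = m/n*n≤m e L ,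
  subst (_< e / L * L + L) (trans (+-comm (e / L * L) (e % L)) (sym (m≡m%n+[m/n]*n e L)))
    (+-monoʳ-< (e / L * L) (m%n<n e L))

same-block⇒≡ : ∀ {L} .{{_ : NonZero L}} {s s' e e'} →
  (s < s' → e + L ≤ e') → (s' < s → e' + L ≤ e) → e / L ≡ e' / L → s ≡ s'
same-block⇒≡ {s = s} {s'} gap gap' eq with <-cmp s s'
... | tri< s<s' _ _ = ⊥-elim (<-irrefl eq (/-mono-gap (gap s<s')))
... | tri≈ _ s≡s' _ = s≡s'
... | tri> _ _ s'<s = ⊥-elim (<-irrefl (sym eq) (/-mono-gap (gap' s'<s)))

⟨$⟩ʳ-injective : ∀ {n} (π : Permutation′ n) {i j} → π ⟨$⟩ʳ i ≡ π ⟨$⟩ʳ j → i ≡ j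
⟨$⟩ʳ-injective π eq = trans (sym (inverseˡ π)) (trans (cong (π ⟨$⟩ˡ_) eq) (inverseˡ π))

cycNext-injective : ∀ {n} {i j : Fin n} → cycNext i ≡ cycNext j → i ≡ j
cycNext-injective {suc k} {i} {j} eq with k ≟ toℕ i | k ≟ toℕ j
... | yes k≡i | yes k≡j = toℕ-injective (trans (sym k≡i) k≡j)
... | yes _   | no  _   = case eq of λ ()
... | no  _   | yes _   = case eq of λ ()
... | no  k≢i | no  k≢j = toℕ-injective
  (trans (sym (toℕ-lower₁ i k≢i)) (trans (cong toℕ (fsuc-injective eq)) (toℕ-lower₁ j k≢j)))

-- The construction

module Construction {n m d L K : ℕ} .{{_ : NonZero L}}
  (dm≤KL : d * m ≤ K * L) (L<m : L < m) (2m≤n : 2 * m ≤ n) (d≤m : d ≤ m) where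

  open Circulant m

  -- Vertices 0, …, n - 1 form X = [0, m), Y = [m, 2m) and Z = [2m, n); an edge is stored as the
  -- pair a < b of its ends. Z is joined to everything, and a ∈ X to m + j ∈ Y when offset a j < d.
  ZEdge CrossEdge Edge : ℕ → ℕ → Set
  ZEdge a b     = a < b × 2 * m ≤ b
  CrossEdge a b = a < m × m ≤ b × b < 2 * m × offset a (b ∸ m) < d
  Edge a b      = ZEdge a b ⊎ CrossEdge a b

  edge? : ∀ a b → Dec (Edge a b)
  edge? a b = (a <? b ×-dec 2 * m ≤? b) ⊎-dec (a <? m ×-dec m ≤? b ×-dec b <? 2 * m ×-dec offset a (b ∸ m) <? d)

  -- The key of the cross edge (a, m + j) lists the matchings offset a j = 0, 1, … one after another;
  -- each block of L consecutive keys is a colour below K, and every edge at Z has a colour of its own.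
  edgeColour : ℕ → ℕ → ℕ
  edgeColour a b with b <? 2 * m
  ... | yes _ = key a (b ∸ m) / L
  ... | no  _ = K + (a * n + b)

  adjacent : ℕ → ℕ → Bool
  adjacent x y = ⌊ edge? (x ⊓ y) (x ⊔ y) ⌋

  colourOf : ℕ → ℕ → ℕ
  colourOf x y = edgeColour (x ⊓ y) (x ⊔ y)

  adjacent-comm : ∀ x y → adjacent x y ≡ adjacent y x
  adjacent-comm x y = cong₂ (λ a b → ⌊ edge? a b ⌋) (⊓-comm x y) (⊔-comm x y)

  colourOf-comm : ∀ x y → colourOf x y ≡ colourOf y x
  colourOf-comm x y = cong₂ edgeColour (⊓-comm x y) (⊔-comm x y)

  Edge⇒< : ∀ {a b} → Edge a b → a < b
  Edge⇒< (inj₁ (a<b , _))       = a<b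
  Edge⇒< (inj₂ (a<m , m≤b , _)) = <-≤-trans a<m m≤b

  adjacent-irrefl : ∀ x → adjacent x x ≡ false
  adjacent-irrefl x rewrite ⊓-idem x | ⊔-idem x with edge? x x
  ... | yes e = ⊥-elim (<-irrefl refl (Edge⇒< e))
  ... | no  _ = refl

  G : Graph n
  G = record
    { adj   = λ u v → adjacent (toℕ u) (toℕ v)
    ; sym   = λ u v → adjacent-comm (toℕ u) (toℕ v)
    ; irref = λ v → adjacent-irrefl (toℕ v)
    }

  κ : EdgeColouring G
  κ = record
    { col    = λ u v → colourOf (toℕ u) (toℕ v)
    ; colSym = λ u v → colourOf-comm (toℕ u) (toℕ v)
    }

  ⊓⊔-< : ∀ {x y} → x < y → x ⊓ y ≡ x × x ⊔ y ≡ y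
  ⊓⊔-< x<y = m≤n⇒m⊓n≡m (<⇒≤ x<y) , m≤n⇒m⊔n≡n (<⇒≤ x<y)

  adjacent⁺ : ∀ {a b} → Edge a b → T (adjacent a b)
  adjacent⁺ {a} {b} e with ⊓⊔-< (Edge⇒< e)
  ... | ⊓≡ , ⊔≡ = subst₂ (λ x y → T ⌊ edge? x y ⌋) (sym ⊓≡) (sym ⊔≡) (fromWitness e)

  adjacent⁺-sym : ∀ {a b} → Edge a b → T (adjacent b a)
  adjacent⁺-sym {a} {b} e = subst T (adjacent-comm a b) (adjacent⁺ e)

  adjacent⁻ : ∀ {a b} → a < b → T (adjacent a b) → Edge a b
  adjacent⁻ a<b t = let ⊓≡ , ⊔≡ = ⊓⊔-< a<b in toWitness (subst₂ (λ x y → T ⌊ edge? x y ⌋) ⊓≡ ⊔≡ t)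

  colourOf-< : ∀ {a b} → a < b → colourOf a b ≡ edgeColour a b
  colourOf-< a<b = let ⊓≡ , ⊔≡ = ⊓⊔-< a<b in cong₂ edgeColour ⊓≡ ⊔≡

  data Oriented (x y : ℕ) : Set where
    forward  : x < y → Edge x y → colourOf x y ≡ edgeColour x y → Oriented x y
    backward : y < x → Edge y x → colourOf x y ≡ edgeColour y x → Oriented x y

  orient : ∀ {x y} → T (adjacent x y) → Oriented x y
  orient {x} {y} t with <-cmp x y
  ... | tri< x<y _ _ = forward x<y (adjacent⁻ x<y t) (colourOf-< x<y)
  ... | tri> _ _ y<x = backward y<x
    (adjacent⁻ y<x (subst T (adjacent-comm x y) t)) (trans (colourOf-comm x y) (colourOf-< y<x))
  ... | tri≈ _ refl _ = ⊥-elim (subst T (adjacent-irrefl x) t)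

  edgeColour-Z : ∀ {a b} → 2 * m ≤ b → edgeColour a b ≡ K + (a * n + b)
  edgeColour-Z {a} {b} 2m≤b with b <? 2 * m
  ... | yes b<2m = ⊥-elim (<⇒≱ b<2m 2m≤b)
  ... | no  _    = refl

  edgeColour-cross : ∀ {a b} → b < 2 * m → edgeColour a b ≡ key a (b ∸ m) / L
  edgeColour-cross {a} {b} b<2m with b <? 2 * m
  ... | yes _    = refl
  ... | no  b≮2m = ⊥-elim (b≮2m b<2m)

  ∸m<m : ∀ {b} → m ≤ b → b < 2 * m → b ∸ m < m
  ∸m<m {b} m≤b b<2m = +-cancelˡ-< m (b ∸ m) m
    (subst₂ _<_ (sym (m+[n∸m]≡n m≤b)) (cong (m +_) (+-identityʳ m)) b<2m)

  K≤edgeColour-Z : ∀ {a b} → 2 * m ≤ b → K ≤ edgeColour a b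
  K≤edgeColour-Z 2m≤b = subst (K ≤_) (sym (edgeColour-Z 2m≤b)) (m≤m+n K _)

  edgeColour-cross<K : ∀ {a b} → CrossEdge a b → edgeColour a b < K
  edgeColour-cross<K {a} {b} (a<m , m≤b , b<2m , s<d) =
    subst (_< K) (sym (edgeColour-cross b<2m)) (m<n*o⇒m/o<n (<-≤-trans key<dm dm≤KL))
    where
    key<dm : key a (b ∸ m) < d * m
    key<dm = <-≤-trans (+-monoʳ-< (offset a (b ∸ m) * m) (∸m<m m≤b b<2m))
               (subst (_≤ d * m) (+-comm m _) (*-monoˡ-≤ m s<d))

  ShareEnd : ℕ → ℕ → ℕ → ℕ → Set
  ShareEnd a b a' b' = a ≡ a' ⊎ b ≡ b' ⊎ a ≡ b' ⊎ b ≡ a'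

  same-colour⇒same-crossEdge : ∀ {a b a' b'} → CrossEdge a b → CrossEdge a' b' → ShareEnd a b a' b' →
    key a (b ∸ m) / L ≡ key a' (b' ∸ m) / L → a ≡ a' × b ≡ b'
  same-colour⇒same-crossEdge (a<m , m≤b , b<2m , _) (_ , m≤b' , b'<2m , _) (inj₁ refl) eq =
    refl , ∸-cancelʳ-≡ m≤b m≤b' (offset-injectiveʳ a<m j<m j'<m
      (same-block⇒≡ (key-gap-same-a L<m a<m j<m j'<m) (key-gap-same-a L<m a<m j'<m j<m) eq))
    where j<m = ∸m<m m≤b b<2m ; j'<m = ∸m<m m≤b' b'<2m
  same-colour⇒same-crossEdge {a} {b} {a'} (a<m , m≤b , b<2m , _) (a'<m , _ , _ , _) (inj₂ (inj₁ refl)) eq =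
    offset-injectiveˡ a<m a'<m j<m
      (same-block⇒≡ (key-gap-same-j {a = a} {a'} {b ∸ m} (<⇒≤ L<m)) (key-gap-same-j {a = a'} {a} {b ∸ m} (<⇒≤ L<m)) eq) , refl
    where j<m = ∸m<m m≤b b<2m
  same-colour⇒same-crossEdge (a<m , _) (_ , m≤b' , _) (inj₂ (inj₂ (inj₁ refl))) _ = ⊥-elim (<⇒≱ a<m m≤b')
  same-colour⇒same-crossEdge (_ , m≤b , _) (a'<m , _) (inj₂ (inj₂ (inj₂ refl))) _ = ⊥-elim (<⇒≱ a'<m m≤b)

  same-colour⇒same-edge : ∀ {a b a' b'} → b < n → b' < n → Edge a b → Edge a' b' → ShareEnd a b a' b' →
    edgeColour a b ≡ edgeColour a' b' → a ≡ a' × b ≡ b'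
  same-colour⇒same-edge b<n b'<n (inj₁ (_ , 2m≤b)) (inj₁ (_ , 2m≤b')) _ eq =
    *+-injective b<n b'<n (+-cancelˡ-≡ K _ _ (trans (sym (edgeColour-Z 2m≤b)) (trans eq (edgeColour-Z 2m≤b'))))
  same-colour⇒same-edge _ _ (inj₁ (_ , 2m≤b)) (inj₂ c') _ eq =
    ⊥-elim (<⇒≱ (edgeColour-cross<K c') (subst (K ≤_) eq (K≤edgeColour-Z 2m≤b)))
  same-colour⇒same-edge _ _ (inj₂ c) (inj₁ (_ , 2m≤b')) _ eq =
    ⊥-elim (<⇒≱ (edgeColour-cross<K c) (subst (K ≤_) (sym eq) (K≤edgeColour-Z 2m≤b')))
  same-colour⇒same-edge _ _ (inj₂ c@(_ , _ , b<2m , _)) (inj₂ c'@(_ , _ , b'<2m , _)) shared eq =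
    same-colour⇒same-crossEdge c c' shared (trans (sym (edgeColour-cross b<2m)) (trans eq (edgeColour-cross b'<2m)))

  colourOf-proper : ∀ {x y z} → x < n → y < n → z < n → T (adjacent x y) → T (adjacent x z) →
    colourOf x y ≡ colourOf x z → y ≡ z
  colourOf-proper {x} {y} {z} x<n y<n z<n t t' eq with orient t | orient t'
  ... | forward x<y e c | forward x<z e' c' =
    proj₂ (same-colour⇒same-edge y<n z<n e e' (inj₁ refl) (trans (sym c) (trans eq c')))
  ... | backward y<x e c | backward z<x e' c' =
    proj₁ (same-colour⇒same-edge x<n x<n e e' (inj₂ (inj₁ refl)) (trans (sym c) (trans eq c')))
  ... | forward x<y e c | backward z<x e' c' = ⊥-elim (<-irrefl
    (sym (proj₁ (same-colour⇒same-edge y<n x<n e e' (inj₂ (inj₂ (inj₁ refl))) (trans (sym c) (trans eq c'))))) z<x)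
  ... | backward y<x e c | forward x<z e' c' = ⊥-elim (<-irrefl
    (proj₁ (same-colour⇒same-edge x<n z<n e e' (inj₂ (inj₂ (inj₂ refl))) (trans (sym c) (trans eq c')))) y<x)

  proper : Proper κ
  proper u v w t t' v≢w eq = v≢w (toℕ-injective (colourOf-proper (toℕ<n u) (toℕ<n v) (toℕ<n w) t t' eq))

  Zs : List ℕ
  Zs = interval (2 * m) (n ∸ 2 * m)

  ∈-Zs⁻ : ∀ {y} → y ∈ Zs → 2 * m ≤ y × y < n
  ∈-Zs⁻ y∈ = let 2m≤y , y< = ∈-interval⁻ y∈ in 2m≤y , subst (_ <_) (m+[n∸m]≡n 2m≤n) y<

  degree-via-witnesses : ∀ {x} (ws : List ℕ) → Unique ws → (∀ {y} → y ∈ ws → y < n × T (adjacent x y)) →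
    length ws ≤ countᵇ (adjacent x) (upTo n)
  degree-via-witnesses ws !ws ws-adj =
    length≤countᵇ-by-witnesses _ !ws (λ y∈ → let y<n , t = ws-adj y∈ in ∈-upTo⁺ y<n , t)

  degree-XY : ∀ {x} (ns : List ℕ) → x < 2 * m → length ns ≡ d → Unique ns →
    (∀ {y} → y ∈ ns → y < 2 * m × T (adjacent x y)) → n ∸ 2 * m + d ≤ countᵇ (adjacent x) (upTo n)
  degree-XY {x} ns x<2m |ns|≡d !ns ns-adj = subst (_≤ _) |ns++Zs|
    (degree-via-witnesses (ns ++ Zs) (Unique.++⁺ !ns (interval-Unique _ _) disjoint) adj)
    where
    |ns++Zs| : length (ns ++ Zs) ≡ n ∸ 2 * m + d
    |ns++Zs| = trans (length-++ ns) (trans (cong₂ _+_ |ns|≡d (length-applyUpTo _ _)) (+-comm d _))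
    disjoint : ∀ {y} → ¬ (y ∈ ns × y ∈ Zs)
    disjoint (y∈ns , y∈Zs) = <⇒≱ (proj₁ (ns-adj y∈ns)) (proj₁ (∈-Zs⁻ y∈Zs))
    adj : ∀ {y} → y ∈ ns ++ Zs → y < n × T (adjacent x y)
    adj y∈ with ∈-++⁻ ns y∈
    ... | inj₁ y∈ns = let y<2m , t = ns-adj y∈ns in <-≤-trans y<2m 2m≤n , t
    ... | inj₂ y∈Zs = let 2m≤y , y<n = ∈-Zs⁻ y∈Zs in y<n , adjacent⁺ (inj₁ (<-≤-trans x<2m 2m≤y , 2m≤y))

  <m⇒<2m : ∀ {y} → y < m → y < 2 * m
  <m⇒<2m y<m = <-≤-trans y<m (m≤m+n _ _)

  degree-X : ∀ {x} → x < m → n ∸ 2 * m + d ≤ countᵇ (adjacent x) (upTo n)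
  degree-X {x} x<m = degree-XY ns (<m⇒<2m x<m) (trans (length-map _ (upTo d)) (length-upTo d))
    (Unique-map⁺ nbr (λ s∈ s'∈ eq → offset-injectiveʳ x<m (s<m s∈) (s<m s'∈) (+-cancelˡ-≡ m _ _ eq))
      (Unique.upTo⁺ d)) ns-adj
    where
    s<m : ∀ {s} → s ∈ upTo d → s < m
    s<m s∈ = <-≤-trans (∈-upTo⁻ s∈) d≤m
    nbr : ℕ → ℕ
    nbr s = m + offset x s
    ns = map nbr (upTo d)
    ns-adj : ∀ {y} → y ∈ ns → y < 2 * m × T (adjacent x y)
    ns-adj y∈ with ∈-map⁻ nbr y∈
    ... | s , s∈ , refl = nbr<2m , adjacent⁺ (inj₂ (x<m , m≤m+n m _ , nbr<2m , offset<d))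
      where
      nbr<2m = subst (nbr s <_) (cong (m +_) (sym (+-identityʳ m))) (+-monoʳ-< m (offset<m x<m (s<m s∈)))
      offset<d : offset x (nbr s ∸ m) < d
      offset<d = subst (_< d) (sym (trans (cong (offset x) (m+n∸m≡n m _)) (offset-involutive x<m (s<m s∈))))
                   (∈-upTo⁻ s∈)

  degree-Y : ∀ {x} → m ≤ x → x < 2 * m → n ∸ 2 * m + d ≤ countᵇ (adjacent x) (upTo n)
  degree-Y {x} m≤x x<2m = degree-XY ns x<2m (trans (length-map _ (upTo d)) (length-upTo d))
    (Unique-map⁺ (j ⊕_) (λ s∈ s'∈ eq → trans (sym (offset-⊕ j<m (s<m s∈))) (trans (cong (λ a → offset a j) eq)
      (offset-⊕ j<m (s<m s'∈)))) (Unique.upTo⁺ d)) ns-adj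
    where
    j = x ∸ m
    j<m = ∸m<m m≤x x<2m
    s<m : ∀ {s} → s ∈ upTo d → s < m
    s<m s∈ = <-≤-trans (∈-upTo⁻ s∈) d≤m
    ns = map (j ⊕_) (upTo d)
    ns-adj : ∀ {y} → y ∈ ns → y < 2 * m × T (adjacent x y)
    ns-adj y∈ with ∈-map⁻ (j ⊕_) y∈
    ... | s , s∈ , refl = <m⇒<2m a<m ,
      adjacent⁺-sym (inj₂ (a<m , m≤x , x<2m , subst (_< d) (sym (offset-⊕ j<m (s<m s∈))) (∈-upTo⁻ s∈)))
      where a<m = ⊕<m j<m (s<m s∈)

  -- A vertex of Z sees every other vertex.
  degree-Z : ∀ {x} → 2 * m ≤ x → x < n → n ∸ 2 * m + d ≤ countᵇ (adjacent x) (upTo n)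
  degree-Z {x} 2m≤x x<n = ≤-trans bound (subst (_≤ countᵇ (adjacent x) (upTo n)) (length-++ (upTo x))
    (degree-via-witnesses (upTo x ++ above) (Unique.++⁺ (Unique.upTo⁺ x) (interval-Unique _ _) disjoint) adj))
    where
    above = interval (suc x) (n ∸ suc x)
    disjoint : ∀ {y} → ¬ (y ∈ upTo x × y ∈ above)
    disjoint (y∈ , y∈') = <⇒≱ (∈-upTo⁻ y∈) (<⇒≤ (proj₁ (∈-interval⁻ y∈')))
    adj : ∀ {y} → y ∈ upTo x ++ above → y < n × T (adjacent x y)
    adj y∈ with ∈-++⁻ (upTo x) y∈
    ... | inj₁ y∈ = let y<x = ∈-upTo⁻ y∈ in <-trans y<x x<n , adjacent⁺-sym (inj₁ (y<x , 2m≤x))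
    ... | inj₂ y∈ = let x<y , y< = ∈-interval⁻ y∈ in
      subst (_ <_) (m+[n∸m]≡n x<n) y< , adjacent⁺ (inj₁ (x<y , ≤-trans 2m≤x (<⇒≤ x<y)))
    d<2m : d < 2 * m
    d<2m = ≤-<-trans d≤m (m<m+n m (<-≤-trans (≤-<-trans z≤n L<m) (m≤m+n m 0)))
    bound : n ∸ 2 * m + d ≤ length (upTo x) + length above
    bound = s≤s⁻¹ (begin
      suc (n ∸ 2 * m + d)          ≤⟨ +-monoʳ-< (n ∸ 2 * m) d<2m ⟩
      n ∸ 2 * m + 2 * m            ≡⟨ m∸n+n≡m 2m≤n ⟩
      n                            ≡⟨ m+[n∸m]≡n x<n ⟨
      suc x + (n ∸ suc x)          ≡⟨ cong₂ (λ p q → suc (p + q)) (length-upTo x) (length-applyUpTo _ _) ⟨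
      suc (length (upTo x) + length above) ∎)
      where open ≤-Reasoning

  degreeℕ : ∀ {x} → x < n → n ∸ 2 * m + d ≤ countᵇ (adjacent x) (upTo n)
  degreeℕ {x} x<n with x <? m | x <? 2 * m
  ... | yes x<m | _        = degree-X x<m
  ... | no  x≮m | yes x<2m = degree-Y (≮⇒≥ x≮m) x<2m
  ... | no  _   | no  x≮2m = degree-Z (≮⇒≥ x≮2m) x<n

  degree-bound : ∀ v → n ∸ 2 * m + d ≤ degree G v
  degree-bound v = subst (_ ≤_) (sym (countᵇ-allFin n (adjacent (toℕ v)))) (degreeℕ (toℕ<n v))

  ofColour : ℕ → ℕ → ℕ → Bool
  ofColour k a b = (a <ᵇ b) ∧ adjacent a b ∧ (colourOf a b ≡ᵇ k)

  pairs : List (ℕ × ℕ)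
  pairs = cartesianProduct (upTo n) (upTo n)

  edgesOfColour≡countᵇ-pairs : ∀ k → edgesOfColour κ k ≡ countᵇ (uncurry (ofColour k)) pairs
  edgesOfColour≡countᵇ-pairs k = begin
    sum (map (λ u → countᵇ (ofColour k (toℕ u) ∘ toℕ) (allFin n)) (allFin n))
      ≡⟨ cong sum (map-cong (λ u → countᵇ-allFin n (ofColour k (toℕ u))) (allFin n)) ⟩
    sum (map ((λ a → countᵇ (ofColour k a) (upTo n)) ∘ toℕ) (allFin n))
      ≡⟨ cong sum (map-∘toℕ-allFin n (λ a → countᵇ (ofColour k a) (upTo n))) ⟩
    sum (map (λ a → countᵇ (ofColour k a) (upTo n)) (upTo n))
      ≡⟨ sum-countᵇ≡countᵇ-cartesianProduct (ofColour k) (upTo n) (upTo n) ⟩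
    countᵇ (uncurry (ofColour k)) pairs ∎
    where open ≡-Reasoning

  ofColour⁻ : ∀ {k a b} → T (ofColour k a b) → Edge a b × edgeColour a b ≡ k
  ofColour⁻ {k} {a} {b} t with Equivalence.to T-∧ t
  ... | a<ᵇb , t' with Equivalence.to T-∧ t'
  ...   | adj , col≡ᵇk = let a<b = <ᵇ⇒< a b a<ᵇb in
    adjacent⁻ a<b adj , trans (sym (colourOf-< a<b)) (≡ᵇ⇒≡ _ k col≡ᵇk)

  pair-bounds : ∀ {a b} → (a , b) ∈ pairs → a < n × b < n
  pair-bounds {a} {b} ab∈ = let a∈ , b∈ = ∈-cartesianProduct⁻ (upTo n) (upTo n) ab∈ in ∈-upTo⁻ a∈ , ∈-upTo⁻ b∈

  -- A colour k < K lies on cross edges whose keys fill at most the block [kL, kL + L).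
  colour<K-class : ∀ {k} → k < K → countᵇ (uncurry (ofColour k)) pairs ≤ L
  colour<K-class {k} k<K = subst (countᵇ (uncurry (ofColour k)) pairs ≤_) (length-applyUpTo (k * L +_) L)
    (countᵇ≤length-by-injection (uncurry (ofColour k)) keyOf (interval (k * L) L)
      (Unique.cartesianProduct⁺ (Unique.upTo⁺ n) (Unique.upTo⁺ n)) injective into-block)
    where
    keyOf : ℕ × ℕ → ℕ
    keyOf (a , b) = key a (b ∸ m)
    cross : ∀ {a b} → T (ofColour k a b) → CrossEdge a b × key a (b ∸ m) / L ≡ k
    cross t with ofColour⁻ t
    ... | inj₁ (_ , 2m≤b) , col≡k = ⊥-elim (<⇒≱ k<K (subst (K ≤_) col≡k (K≤edgeColour-Z 2m≤b)))
    ... | inj₂ c@(_ , _ , b<2m , _) , col≡k = c , trans (sym (edgeColour-cross b<2m)) col≡k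
    injective : ∀ {p q} → p ∈ pairs → q ∈ pairs → T (uncurry (ofColour k) p) → T (uncurry (ofColour k) q) →
      keyOf p ≡ keyOf q → p ≡ q
    injective {a , b} {a' , b'} _ _ t t' eq with cross t | cross t'
    ... | (a<m , m≤b , b<2m , _) , _ | (a'<m , m≤b' , b'<2m , _) , _ =
      let a≡a' , j≡j' = key-injective a<m a'<m (∸m<m m≤b b<2m) (∸m<m m≤b' b'<2m) eq
      in cong₂ _,_ a≡a' (∸-cancelʳ-≡ m≤b m≤b' j≡j')
    into-block : ∀ {p} → p ∈ pairs → T (uncurry (ofColour k) p) → keyOf p ∈ interval (k * L) L
    into-block {a , b} _ t = let kL≤ , <kL+L = /-block-bounds (proj₂ (cross t)) in ∈-interval⁺ kL≤ <kL+L

  -- Each colour k ≥ K is the code K + (a n + b) of at most one pair a < b.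
  colour≥K-class : ∀ {k} → ¬ k < K → countᵇ (uncurry (ofColour k)) pairs ≤ L
  colour≥K-class {k} k≮K = ≤-trans
    (countᵇ≤length-by-injection (uncurry (ofColour k)) code ((k ∸ K) ∷ [])
      (Unique.cartesianProduct⁺ (Unique.upTo⁺ n) (Unique.upTo⁺ n)) injective (λ {p} _ t → here (code≡k∸K p t)))
    (>-nonZero⁻¹ L)
    where
    code : ℕ × ℕ → ℕ
    code (a , b) = a * n + b
    code≡k∸K : ∀ p → T (uncurry (ofColour k) p) → code p ≡ k ∸ K
    code≡k∸K (a , b) t with ofColour⁻ {k} {a} {b} t
    ... | inj₁ (_ , 2m≤b) , col≡k = trans (sym (m+n∸m≡n K (code (a , b)))) (cong (_∸ K) (trans (sym (edgeColour-Z 2m≤b)) col≡k))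
    ... | inj₂ c , col≡k = ⊥-elim (k≮K (subst (_< K) col≡k (edgeColour-cross<K c)))
    injective : ∀ {p q} → p ∈ pairs → q ∈ pairs → T (uncurry (ofColour k) p) → T (uncurry (ofColour k) q) →
      code p ≡ code q → p ≡ q
    injective {a , b} {a' , b'} p∈ q∈ _ _ eq =
      let a≡a' , b≡b' = *+-injective (proj₂ (pair-bounds p∈)) (proj₂ (pair-bounds q∈)) eq in cong₂ _,_ a≡a' b≡b'

  colour-classes : ∀ k → edgesOfColour κ k ≤ L
  colour-classes k with k <? K
  ... | yes k<K = subst (_≤ L) (sym (edgesOfColour≡countᵇ-pairs k)) (colour<K-class k<K)
  ... | no  k≮K = subst (_≤ L) (sym (edgesOfColour≡countᵇ-pairs k)) (colour≥K-class k≮K)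

  inZ : ℕ → Bool
  inZ x = 2 * m ≤ᵇ x

  high-colour⇒touches-Z : ∀ {x y} → T (adjacent x y) → ¬ colourOf x y < K → T (inZ x ∨ inZ y)
  high-colour⇒touches-Z t high with orient t
  ... | forward  _ (inj₁ (_ , 2m≤y)) _ = Equivalence.from T-∨ (inj₂ (≤⇒≤ᵇ 2m≤y))
  ... | backward _ (inj₁ (_ , 2m≤x)) _ = Equivalence.from T-∨ (inj₁ (≤⇒≤ᵇ 2m≤x))
  ... | forward  _ (inj₂ c) col≡ = ⊥-elim (high (subst (_< K) (sym col≡) (edgeColour-cross<K c)))
  ... | backward _ (inj₂ c) col≡ = ⊥-elim (high (subst (_< K) (sym col≡) (edgeColour-cross<K c)))

  positions-in-Z≤|Z| : (g : Fin n → Fin n) → (∀ {i j} → g i ≡ g j → i ≡ j) →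
    countᵇ (inZ ∘ toℕ ∘ g) (allFin n) ≤ n ∸ 2 * m
  positions-in-Z≤|Z| g g-injective = subst (countᵇ (inZ ∘ toℕ ∘ g) (allFin n) ≤_) (length-applyUpTo _ _)
    (countᵇ≤length-by-injection (inZ ∘ toℕ ∘ g) (toℕ ∘ g) Zs (Unique.allFin⁺ n)
      (λ _ _ _ _ eq → g-injective (toℕ-injective eq))
      (λ {i} _ t → ∈-interval⁺ (≤ᵇ⇒≤ _ _ t) (subst (toℕ (g i) <_) (sym (m+[n∸m]≡n 2m≤n)) (toℕ<n (g i)))))

  -- A colour ≥ K is used only at Z, and a Hamilton cycle has at most 2|Z| edges at Z.
  colours-on-Hamilton-cycle : (H : HamiltonCycle G) → coloursOn κ H ≤ K + 2 * (n ∸ 2 * m)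
  colours-on-Hamilton-cycle H = begin
    length ds                                               ≡⟨ length≡countᵇ+countᵇ-not low ds ⟩
    countᵇ low ds + countᵇ high ds                          ≤⟨ +-mono-≤ few-low (countᵇ-mono-⊆ high !ds ds⊆cs) ⟩
    K + countᵇ high cs                                      ≡⟨ cong (K +_) (countᵇ-map high colourAt (allFin n)) ⟩
    K + countᵇ (high ∘ colourAt) (allFin n)                 ≤⟨ +-monoʳ-≤ K (countᵇ-mono _ _ (allFin n) touches) ⟩
    K + countᵇ (λ i → inZ (at i) ∨ inZ (at (cycNext i))) (allFin n)
      ≤⟨ +-monoʳ-≤ K (countᵇ-∨ (inZ ∘ at) (inZ ∘ at ∘ cycNext) (allFin n)) ⟩
    K + (countᵇ (inZ ∘ at) (allFin n) + countᵇ (inZ ∘ at ∘ cycNext) (allFin n))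
      ≤⟨ +-monoʳ-≤ K (+-mono-≤ (positions-in-Z≤|Z| (π ⟨$⟩ʳ_) (⟨$⟩ʳ-injective π))
                                (positions-in-Z≤|Z| ((π ⟨$⟩ʳ_) ∘ cycNext) (cycNext-injective ∘ ⟨$⟩ʳ-injective π))) ⟩
    K + ((n ∸ 2 * m) + (n ∸ 2 * m))                         ≡⟨ cong (λ z → K + ((n ∸ 2 * m) + z)) (+-identityʳ _) ⟨
    K + 2 * (n ∸ 2 * m)                                     ∎
    where
    open ≤-Reasoning
    π = HamiltonCycle.σ H
    at : Fin n → ℕ
    at i = toℕ (π ⟨$⟩ʳ i)
    colourAt : Fin n → ℕ
    colourAt i = colourOf (at i) (at (cycNext i))
    cs = map colourAt (allFin n)
    ds = deduplicate _≟_ cs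
    !ds : Unique ds
    !ds = deduplicate-! _≟_ cs
    ds⊆cs : ∀ {z} → z ∈ ds → z ∈ cs
    ds⊆cs = ∈-deduplicate⁻ _≟_ cs
    low high : ℕ → Bool
    low z = z <ᵇ K
    high = not ∘ low
    few-low : countᵇ low ds ≤ K
    few-low = subst (countᵇ low ds ≤_) (length-upTo K)
      (countᵇ≤length-by-injection low id (upTo K) !ds (λ _ _ _ _ eq → eq) (λ _ t → ∈-upTo⁺ (<ᵇ⇒< _ K t)))
    touches : ∀ i → T (high (colourAt i)) → T (inZ (at i) ∨ inZ (at (cycNext i)))
    touches i t = high-colour⇒touches-Z (HamiltonCycle.edges H i)
      (λ c<K → subst T (Equivalence.to T-not-≡ t) (<⇒<ᵇ c<K))

construction : ∀ n m d L K .{{_ : NonZero L}} → d * m ≤ K * L → L < m → 2 * m ≤ n → d ≤ m →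
  Σ (Graph n) λ G → (∀ v → n ∸ 2 * m + d ≤ degree G v) × Σ (EdgeColouring G) λ κ →
    Proper κ × (∀ k → edgesOfColour κ k ≤ L) × (∀ H → coloursOn κ H ≤ K + 2 * (n ∸ 2 * m))
construction n m d L K dm≤KL L<m 2m≤n d≤m = G , degree-bound , κ , proper , colour-classes , colours-on-Hamilton-cycle
  where open Construction {n} {m} {d} {L} {K} dm≤KL L<m 2m≤n d≤m

-- Choice of parameters

≤-by-slack : ∀ {x y} s → x + s ≡ y → x ≤ y
≤-by-slack {x} s refl = m≤m+n x s

-- For c = p / (1 + a) > 1/8, in units of t = ⌊n / B⌋: |X| = |Y| = M t, d = D t, L = E t, K = C t,
-- |Z| = Z t + (n mod B), and ε = 1 / (1 + N).
record Scales (a : ℕ) : Set where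
  field
    B M E D C Z N : ℕ
    B≡Z+2M      : B ≡ Z + 2 * M
    DM≡CE       : D * M ≡ C * E
    E<M         : E < M
    D≤M         : D ≤ M
    blocks-fit  : 8 * (E * suc a) ≡ (2 + a) * B
    degree-gain : (3 + N) * B ≤ 2 * (1 + N) * (Z + D)
    few-colours : (1 + N) * (C + 2 * Z + 2) ≤ N * B
    1≤E         : 1 ≤ E
    1≤B         : 1 ≤ B
    1≤N         : 1 ≤ N

scales : ∀ a → Scales a
scales a = record
  { B = 24 * (1 + a) * (2 + a) * (2 + a)
  ; M = 3 * (3 + 2 * a) * (2 + a) * (2 + a)
  ; E = 3 * (2 + a) * (2 + a) * (2 + a)
  ; D = (13 + 6 * a) * (2 + a)
  ; C = (13 + 6 * a) * (3 + 2 * a)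
  ; Z = 6 * (1 + 2 * a) * (2 + a) * (2 + a)
  ; N = 24 * (1 + a) * (2 + a)
  ; B≡Z+2M      = solve (a ∷ [])
  ; DM≡CE       = solve (a ∷ [])
  ; E<M         = ≤-by-slack (11 + 24 * a + 15 * a * a + 3 * a * a * a) (solve (a ∷ []))
  ; D≤M         = ≤-by-slack (10 + 35 * a + 27 * a * a + 6 * a * a * a) (solve (a ∷ []))
  ; blocks-fit  = solve (a ∷ [])
  ; degree-gain = ≤-by-slack (2 * (2 + a)) (solve (a ∷ []))
  ; few-colours = ≤-by-slack (247 + 508 * a + 336 * a * a + 72 * a * a * a) (solve (a ∷ []))
  ; 1≤E         = ≤-by-slack (23 + 36 * a + 18 * a * a + 3 * a * a * a) (solve (a ∷ []))
  ; 1≤B         = ≤-by-slack (95 + 192 * a + 120 * a * a + 24 * a * a * a) (solve (a ∷ []))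
  ; 1≤N         = ≤-by-slack (47 + 72 * a + 24 * a * a) (solve (a ∷ []))
  }

n/B-large : ∀ {n B} .{{_ : NonZero B}} → B * B < n → B ≤ n / B
n/B-large {n} {B} B²<n = subst (_≤ n / B) (m*n/n≡m B B) (/-monoˡ-≤ B (<⇒≤ B²<n))

degree-arithmetic : ∀ {n r t N B Z D} → n ≡ r + t * B → 1 ≤ N → (3 + N) * B ≤ 2 * (1 + N) * (Z + D) →
  (3 + N) * n ≤ (r + Z * t + D * t) * (2 + 2 * N)
degree-arithmetic {n} {r} {t} {N} {B} {Z} {D} refl 1≤N gain = begin
  (3 + N) * (r + t * B)                       ≡⟨ solve (r ∷ t ∷ N ∷ B ∷ []) ⟩
  (3 + N) * r + (3 + N) * B * t               ≤⟨ +-mono-≤ (*-monoˡ-≤ r 3+N≤2+2N) (*-monoˡ-≤ t gain) ⟩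
  (2 + 2 * N) * r + 2 * (1 + N) * (Z + D) * t ≡⟨ solve (r ∷ t ∷ N ∷ Z ∷ D ∷ []) ⟩
  (r + Z * t + D * t) * (2 + 2 * N)           ∎
  where
  open ≤-Reasoning
  3+N≤2+2N : 3 + N ≤ 2 + 2 * N
  3+N≤2+2N = +-monoʳ-≤ 2 (≤-trans (+-monoˡ-≤ N 1≤N) (≤-reflexive (cong (N +_) (sym (+-identityʳ N)))))

-- The remainder r ≤ t is charged to t.
hamilton-arithmetic : ∀ {n r t N B C Z} → n ≡ r + t * B → r ≤ t → (1 + N) * (C + 2 * Z + 2) ≤ N * B →
  (C * t + 2 * (r + Z * t)) * suc N ≤ N * n
hamilton-arithmetic {n} {r} {t} {N} {B} {C} {Z} refl r≤t few = begin
  (C * t + 2 * (r + Z * t)) * suc N           ≡⟨ solve (r ∷ t ∷ N ∷ C ∷ Z ∷ []) ⟩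
  (1 + N) * (C + 2 * Z) * t + 2 * (1 + N) * r ≤⟨ +-monoʳ-≤ ((1 + N) * (C + 2 * Z) * t) (*-monoʳ-≤ (2 * (1 + N)) r≤t) ⟩
  (1 + N) * (C + 2 * Z) * t + 2 * (1 + N) * t ≡⟨ solve (t ∷ N ∷ C ∷ Z ∷ []) ⟩
  (1 + N) * (C + 2 * Z + 2) * t               ≤⟨ *-monoˡ-≤ t few ⟩
  N * B * t                                   ≡⟨ solve (t ∷ N ∷ B ∷ []) ⟩
  N * (t * B)                                 ≤⟨ *-monoʳ-≤ N (m≤n+m (t * B) r) ⟩
  N * (r + t * B)                             ∎
  where open ≤-Reasoning

blocks-arithmetic : ∀ {n r t a p E B} → n ≡ r + t * B → 2 + a ≤ p * 8 → 8 * (E * suc a) ≡ (2 + a) * B →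
  E * t * suc a ≤ p * n
blocks-arithmetic {n} {r} {t} {a} {p} {E} {B} refl 2+a≤8p fit = ≤-trans (*-cancelˡ-≤ 8 (begin
  8 * (E * t * suc a)   ≡⟨ solve (t ∷ a ∷ E ∷ []) ⟩
  8 * (E * suc a) * t   ≡⟨ cong (_* t) fit ⟩
  (2 + a) * B * t       ≤⟨ *-monoˡ-≤ t (*-monoˡ-≤ B 2+a≤8p) ⟩
  p * 8 * B * t         ≡⟨ solve (t ∷ p ∷ B ∷ []) ⟩
  8 * (p * (t * B))     ∎)) (*-monoʳ-≤ p (m≤n+m (t * B) r))
  where open ≤-Reasoning

module Units {a} (S : Scales a) {n} (B²<n : Scales.B S * Scales.B S < n) where
  open Scales S

  instance
    B≢0 : NonZero B
    B≢0 = >-nonZero 1≤B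

  t r : ℕ
  t = n / B
  r = n % B

  instance
    t≢0 : NonZero t
    t≢0 = >-nonZero (≤-trans 1≤B (n/B-large B²<n))
    L≢0 : NonZero (E * t)
    L≢0 = m*n≢0 E t {{>-nonZero 1≤E}}

  n≡r+tB : n ≡ r + t * B
  n≡r+tB = m≡m%n+[m/n]*n n B

  r≤t : r ≤ t
  r≤t = ≤-trans (<⇒≤ (m%n<n n B)) (n/B-large B²<n)

  n≡|Z|+2m : n ≡ r + Z * t + 2 * (M * t)
  n≡|Z|+2m = trans n≡r+tB (trans (cong (λ x → r + t * x) B≡Z+2M) (split r t Z M))
    where split : ∀ r t Z M → r + t * (Z + 2 * M) ≡ r + Z * t + 2 * (M * t)
          split = solve-∀

  2m≤n : 2 * (M * t) ≤ n
  2m≤n = subst (2 * (M * t) ≤_) (sym n≡|Z|+2m) (m≤n+m (2 * (M * t)) (r + Z * t))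

  n∸2m≡|Z| : n ∸ 2 * (M * t) ≡ r + Z * t
  n∸2m≡|Z| = trans (cong (_∸ 2 * (M * t)) n≡|Z|+2m) (m+n∸n≡m (r + Z * t) (2 * (M * t)))

  dm≤KL : D * t * (M * t) ≤ C * t * (E * t)
  dm≤KL = ≤-reflexive (trans (rescale D M t) (trans (cong (_* (t * t)) DM≡CE) (sym (rescale C E t))))
    where rescale : ∀ x y t → x * t * (y * t) ≡ x * y * (t * t)
          rescale = solve-∀

scaled-construction : ∀ {a p} (S : Scales a) → 2 + a ≤ p * 8 → let open Scales S in
  ∀ n → B * B < n → Σ (Graph n) λ G → (∀ v → (3 + N) * n ≤ degree G v * (2 + 2 * N)) ×
    Σ (EdgeColouring G) λ κ → Proper κ × (∀ k → edgesOfColour κ k * suc a ≤ p * n) ×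
      (∀ H → coloursOn κ H * suc N ≤ N * n)
scaled-construction {a} {p} S 2+a≤8p n B²<n =
  let G , degree≥ , κ , proper , classes≤L , colours≤ =
        construction n (M * t) (D * t) (E * t) (C * t) dm≤KL (*-monoˡ-< t E<M) 2m≤n (*-monoˡ-≤ t D≤M)
  in G
   , (λ v → ≤-trans (degree-arithmetic {r = r} {t} {N} {B} {Z} {D} n≡r+tB 1≤N degree-gain)
              (*-monoˡ-≤ (2 + 2 * N) (subst (λ z → z + D * t ≤ degree G v) n∸2m≡|Z| (degree≥ v))))
   , κ , proper
   , (λ k → ≤-trans (*-monoˡ-≤ (suc a) (classes≤L k))
              (blocks-arithmetic {r = r} {t} {a} {p} {E} {B} n≡r+tB 2+a≤8p blocks-fit))
   , λ H → ≤-trans (*-monoˡ-≤ (suc N) (subst (λ z → coloursOn κ H ≤ C * t + 2 * z) n∸2m≡|Z| (colours≤ H)))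
              (hamilton-arithmetic {r = r} {t} {N} {B} {C} {Z} n≡r+tB r≤t few-colours)
  where
  open Scales S
  open Units S B²<n

-- Back to the rationals

private
  toℚᵘ-ℕtoℚ : ∀ k → toℚᵘ (ℕtoℚ k) ≃ᵘ mkℚᵘ (ℤ.+ k) 0
  toℚᵘ-ℕtoℚ k = toℚᵘ-fromℚᵘ (mkℚᵘ (ℤ.+ k) 0)

  mkℚᵘ-*-ℕ : ∀ u v x → mkℚᵘ (ℤ.+ u) v ℚᵘ.* mkℚᵘ (ℤ.+ x) 0 ≃ᵘ mkℚᵘ (ℤ.+ (u * x)) v
  mkℚᵘ-*-ℕ u v x = ℚᵘ.≃-reflexive (cong₂ mkℚᵘ (sym (ℤ.pos-* u x)) (*-identityʳ v))

  mkℚᵘ-≤ : ∀ {u v u' v'} → u * suc v' ≤ u' * suc v → mkℚᵘ (ℤ.+ u) v ℚᵘ.≤ mkℚᵘ (ℤ.+ u') v'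
  mkℚᵘ-≤ {u} {v} {u'} {v'} h = ℚᵘ.*≤* (subst₂ ℤ._≤_ (ℤ.pos-* u (suc v')) (ℤ.pos-* u' (suc v)) (ℤ.+≤+ h))

  toℚᵘ-*ℕtoℚ : ∀ {r u v} x → toℚᵘ r ≃ᵘ mkℚᵘ (ℤ.+ u) v → toℚᵘ (r Q.* ℕtoℚ x) ≃ᵘ mkℚᵘ (ℤ.+ (u * x)) v
  toℚᵘ-*ℕtoℚ {r} {u} {v} x r≃ =
    ℚᵘ.≃-trans (toℚᵘ-homo-* r (ℕtoℚ x)) (ℚᵘ.≃-trans (ℚᵘ.*-cong r≃ (toℚᵘ-ℕtoℚ x)) (mkℚᵘ-*-ℕ u v x))

*ℕtoℚ≤ℕtoℚ : ∀ {r u v} x k → toℚᵘ r ≃ᵘ mkℚᵘ (ℤ.+ u) v → u * x ≤ k * suc v → r Q.* ℕtoℚ x Q.≤ ℕtoℚ k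
*ℕtoℚ≤ℕtoℚ {r} {u} {v} x k r≃ h = toℚᵘ-cancel-≤
  (ℚᵘ.≤-respˡ-≃ (ℚᵘ.≃-sym (toℚᵘ-*ℕtoℚ x r≃)) (ℚᵘ.≤-respʳ-≃ (ℚᵘ.≃-sym (toℚᵘ-ℕtoℚ k))
    (mkℚᵘ-≤ (subst (_≤ k * suc v) (sym (*-identityʳ (u * x))) h))))

ℕtoℚ≤*ℕtoℚ : ∀ {r u v} x k → toℚᵘ r ≃ᵘ mkℚᵘ (ℤ.+ u) v → k * suc v ≤ u * x → ℕtoℚ k Q.≤ r Q.* ℕtoℚ x
ℕtoℚ≤*ℕtoℚ {r} {u} {v} x k r≃ h = toℚᵘ-cancel-≤
  (ℚᵘ.≤-respʳ-≃ (ℚᵘ.≃-sym (toℚᵘ-*ℕtoℚ x r≃)) (ℚᵘ.≤-respˡ-≃ (ℚᵘ.≃-sym (toℚᵘ-ℕtoℚ k))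
    (mkℚᵘ-≤ (subst (k * suc v ≤_) (sym (*-identityʳ (u * x))) h))))

ε : ℕ → ℚ
ε N = mkℚ (ℤ.+ 1) N (1-coprimeTo (suc N))

ε-positive : ∀ N → 0ℚ Q.< ε N
ε-positive N = Q.*<* (ℤ.+<+ (s≤s z≤n))

½+ε≃ : ∀ N → toℚᵘ (½ Q.+ ε N) ≃ᵘ mkℚᵘ (ℤ.+ (3 + N)) (1 + 2 * N)
½+ε≃ N = ℚᵘ.≃-trans (toℚᵘ-homo-+ ½ (ε N)) (ℚᵘ.≃-reflexive (cong₂ mkℚᵘ
  (trans (sym (ℤ.pos-+ (1 * suc N) (1 * 2))) (cong ℤ.+_ (solve (N ∷ [])))) (solve (N ∷ []))))

1-ε≃ : ∀ N → toℚᵘ (1ℚ Q.- ε N) ≃ᵘ mkℚᵘ (ℤ.+ N) N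
1-ε≃ N = ℚᵘ.≃-trans (toℚᵘ-homo-+ 1ℚ (Q.- ε N)) (ℚᵘ.≃-trans (ℚᵘ.+-congʳ (toℚᵘ 1ℚ) (toℚᵘ-homo‿- (ε N)))
  (ℚᵘ.≃-reflexive (cong (λ x → mkℚᵘ (ℤ.+ x) x) (+-identityʳ N))))

proposition1p2 : (c : ℚ) → (ℤ.+ 1 Q./ 8) Q.< c →
    Σ ℕ λ n₀ → Σ ℚ λ ε → (0ℚ Q.< ε) ×
    ((n : ℕ) → n₀ < n →
    Σ (Graph n) λ G →
    MinDegreeAtLeast G (½ Q.+ ε) ×
    Σ (EdgeColouring G) λ κ →
    Proper κ × Bounded κ (c Q.* ℕtoℚ n) ×
    ((H : HamiltonCycle G) → ℕtoℚ (coloursOn κ H) Q.≤ (1ℚ Q.- ε) Q.* ℕtoℚ n))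
proposition1p2 (mkℚ -[1+ _ ] _ _) (Q.*<* ())
proposition1p2 (mkℚ (ℤ.+ p) a _) (Q.*<* 1+a<8p) = B * B , ε N , ε-positive N , λ n B²<n →
  let G , degree-ok , κ , proper , classes-ok , hamilton-ok = scaled-construction {p = p} S 2+a≤8p n B²<n
  in G , (λ v → *ℕtoℚ≤ℕtoℚ n (degree G v) (½+ε≃ N) (degree-ok v)) , κ , proper
   , (λ k → ℕtoℚ≤*ℕtoℚ n (edgesOfColour κ k) ℚᵘ.≃-refl (classes-ok k))
   , (λ H → ℕtoℚ≤*ℕtoℚ n (coloursOn κ H) (1-ε≃ N) (hamilton-ok H))
  where
  S = scales a
  open Scales S
  2+a≤8p : 2 + a ≤ p * 8
  2+a≤8p = subst (_≤ p * 8) (cong (2 +_) (+-identityʳ a))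
    (ℤ.drop‿+<+ (subst₂ ℤ._<_ (sym (ℤ.pos-* 1 (suc a))) (sym (ℤ.pos-* p 8)) 1+a<8p))
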